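{- For $M\in\Lambda_{\circledR}$: if $M\twoheadrightarrow N$ then $Fv(M)=Fv(N)$.
   Context: Fix a countably infinite set of variables. The set $\Lambda_{\circledR}$ of terms and $Fv(M)$ are defined simultaneously: every variable $x$ is a term with $Fv(x)=\{x\}$; $\lambda x.M$ is a term if $M$ is a term and $x\in Fv(M)$ ($Fv=Fv(M)\setminus\{x\}$); $MN$ is a term if $M,N$ are terms with $Fv(M)\cap Fv(N)=\emptyset$ ($Fv=Fv(M)\cup Fv(N)$); $x\odot M$ (erasure) is a term if $M$ is a term and $x\notin Fv(M)$ ($Fv=\{x\}\cup Fv(M)$); $x<^{x_1}_{x_2}M$ (duplication) is a term if $M$ is a term, $x_1,x_2\in Fv(M)$, $x_1\neq x_2$, $x\notin Fv(M)\setminus\{x_1,x_2\}$ ($Fv=\{x\}\cup(Fv(M)\setminus\{x_1,x_2\})$). $\lambda x$ binds $x$, duplication binds $x_1,x_2$; $\alpha$-conversion and Barendregt's convention are assumed. $Fv[M]$ is the ordered list of free variables; $X\odot M$ and $X<^{Y}_{Z}M$ denote iterated erasures/duplications over lists. Substitution $M\langle N/x\rangle$ (for $M,N\in\Lambda_{\circledR}$, $x\in Fv(M)$, $(Fv(M)\setminus\{x\})\cap Fv(N)=\emptyset$) is the unique normal form of the explicit substitution $M[N/x]$ under the rules: $x[N/x]\to N$; $(\lambda y.M)[N/x]\to\lambda y.M[N/x]$ ($y\ne x$); $(MP)[N/x]\to M[N/x]P$ if $x\in Fv(M)$; $(MP)[N/x]\to M\,P[N/x]$ if $x\in Fv(P)$;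 $(y\odot M)[N/x]\to y\odot M[N/x]$ ($y\neq x$); $(x\odot M)[N/x]\to Fv(N)\odot M$; $(y<^{y_1}_{y_2}M)[N/x]\to y<^{y_1}_{y_2}M[N/x]$ ($y\ne x$); $(x<^{x_1}_{x_2}M)[N/x]\to Fv[N]<^{Fv[N_1]}_{Fv[N_2]}M[N_1/x_1][N_2/x_2]$ ($N_1,N_2$ fresh renamings of $N$). Reduction $\rightarrow$ is the contextual closure, modulo structural equivalence, of: $(\lambda x.M)N\to M\langle N/x\rangle$; $x<^{x_1}_{x_2}(\lambda y.M)\to\lambda y.x<^{x_1}_{x_2}M$; $x<^{x_1}_{x_2}(MN)\to(x<^{x_1}_{x_2}M)N$ if $x_1,x_2\notin Fv(N)$; $x<^{x_1}_{x_2}(MN)\to M(x<^{x_1}_{x_2}N)$ if $x_1,x_2\notin Fv(M)$; $\lambda x.(y\odot M)\to y\odot(\lambda x.M)$ ($x\neq y$); $(x\odot M)N\to x\odot(MN)$; $M(x\odot N)\to x\odot(MN)$; $x<^{x_1}_{x_2}(y\odot M)\to y\odot(x<^{x_1}_{x_2}M)$ ($y\ne x_1,x_2$); $x<^{x_1}_{x_2}(x_1\odot M)\to M\langle x/x_2\rangle$. Structural equivalence is the least equivalence closed under $\alpha$-conversion containing $x\odot(y\odot M)\equiv y\odot(x\odot M)$; $x<^{x_1}_{x_2}M\equiv x<^{x_2}_{x_1}M$; $x<^{y}_{z}(y<^{u}_{v}M)\equiv x<^{y}_{u}(y<^{z}_{v}M)$; $x<^{x_1}_{x_2}(y<^{y_1}_{y_2}M)\equiv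 y<^{y_1}_{y_2}(x<^{x_1}_{x_2}M)$ if $x\ne y_1,y_2$, $y\ne x_1,x_2$. $\twoheadrightarrow$ is the reflexive-transitive closure of $\to$. -}

module Defs where

open import Data.Nat using (ℕ; _≟_)
open import Data.Bool using (if_then_else_)
open import Data.List using (List; []; _∷_; _++_; length)
open import Data.Product using (_×_; _,_)
open import Data.List.Membership.Propositional using (_∈_; _∉_)
open import Data.List.Relation.Unary.All using (All)
open import Data.List.Relation.Unary.Unique.Propositional using (Unique)
open import Relation.Nullary using (does)
open import Relation.Binary.PropositionalEquality using (_≡_; _≢_)
open import Relation.Binary.Construct.Closure.ReflexiveTransitive using (Star)

-- Raw terms of the resource control calculus (variables are naturals)
--   var x          : x
--   lam x M        : λx.M
--   app M N        : M N
--   era x M        : x ⊙ M            (erasure)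
--   dup x x₁ x₂ M  : x <^{x₁}_{x₂} M   (duplication, binds x₁ x₂ in M)

data Term : Set where
  var : ℕ → Term
  lam : ℕ → Term → Term
  app : Term → Term → Term
  era : ℕ → Term → Term
  dup : ℕ → ℕ → ℕ → Term → Term

remove : ℕ → List ℕ → List ℕ
remove x [] = []
remove x (y ∷ ys) = if does (x ≟ y) then remove x ys else (y ∷ remove x ys)

-- Fv[M]: the (ordered, left-to-right) list of free variables; Fv(M) is
-- its underlying set (membership _∈_).
fv : Term → List ℕ
fv (var x) = x ∷ []
fv (lam x M) = remove x (fv M)
fv (app M N) = fv M ++ fv N
fv (era x M) = x ∷ fv M
fv (dup x x₁ x₂ M) = x ∷ remove x₂ (remove x₁ (fv M))

vars : Term → List ℕ
vars (var x) = x ∷ []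
vars (lam x M) = x ∷ vars M
vars (app M N) = vars M ++ vars N
vars (era x M) = x ∷ vars M
vars (dup x x₁ x₂ M) = x ∷ x₁ ∷ x₂ ∷ vars M

Disjoint : List ℕ → List ℕ → Set
Disjoint xs ys = ∀ {z} → z ∈ xs → z ∉ ys

-- The set Λ® of (well-formed) terms

data WF : Term → Set where
  wf-var : ∀ {x} → WF (var x)
  wf-lam : ∀ {x M} → WF M → x ∈ fv M → WF (lam x M)
  wf-app : ∀ {M N} → WF M → WF N → Disjoint (fv M) (fv N) → WF (app M N)
  wf-era : ∀ {x M} → WF M → x ∉ fv M → WF (era x M)
  wf-dup : ∀ {x x₁ x₂ M} → WF M → x₁ ∈ fv M → x₂ ∈ fv M → x₁ ≢ x₂ →
           x ∉ remove x₂ (remove x₁ (fv M)) → WF (dup x x₁ x₂ M)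

swapV : ℕ → ℕ → ℕ → ℕ
swapV a b x = if does (x ≟ a) then b else (if does (x ≟ b) then a else x)

swap : ℕ → ℕ → Term → Term
swap a b (var x) = var (swapV a b x)
swap a b (lam x M) = lam (swapV a b x) (swap a b M)
swap a b (app M N) = app (swap a b M) (swap a b N)
swap a b (era x M) = era (swapV a b x) (swap a b M)
swap a b (dup x x₁ x₂ M) = dup (swapV a b x) (swapV a b x₁) (swapV a b x₂) (swap a b M)

-- rename a₁ ↦ b₁, …, aₙ ↦ bₙ (b's fresh and distinct, so swapping = renaming)
renameList : List ℕ → List ℕ → Term → Term
renameList (a ∷ as) (b ∷ bs) N = swap a b (renameList as bs N)
renameList _ _ N = N

eras : List ℕ → Term → Term
eras [] M = M
eras (x ∷ xs) M = era x (eras xs M)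

dups : List ℕ → List ℕ → List ℕ → Term → Term
dups (x ∷ xs) (y ∷ ys) (z ∷ zs) M = dup x y z (dups xs ys zs M)
dups _ _ _ M = M

-- Evaluation of the explicit substitution M[N/x] to its normal form P
-- (ES M N x P), following the rules of the paper.  Side conditions
-- y ≢ x, y ∉ Fv(N) on bound variables express Barendregt's convention.

Fresh : List ℕ → Term → List ℕ → Set
Fresh avoid N ys = Unique ys × length ys ≡ length (fv N) × All (λ y → y ∉ avoid) ys

data ES : Term → Term → ℕ → Term → Set where
  es-var   : ∀ {x N} → ES (var x) N x N
  es-lam   : ∀ {x y M N P} → y ≢ x → y ∉ fv N → ES M N x P →
             ES (lam y M) N x (lam y P)
  es-appL  : ∀ {x M Q N P} → x ∈ fv M → ES M N x P →
             ES (app M Q) N x (app P Q)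
  es-appR  : ∀ {x M Q N P} → x ∈ fv Q → ES Q N x P →
             ES (app M Q) N x (app M P)
  es-era   : ∀ {x y M N P} → y ≢ x → ES M N x P →
             ES (era y M) N x (era y P)
  es-eraX  : ∀ {x M N} → ES (era x M) N x (eras (fv N) M)
  es-dup   : ∀ {x y y₁ y₂ M N P} → y ≢ x → y₁ ≢ x → y₂ ≢ x →
             y₁ ∉ fv N → y₂ ∉ fv N → ES M N x P →
             ES (dup y y₁ y₂ M) N x (dup y y₁ y₂ P)
  es-dupX  : ∀ {x x₁ x₂ M N ys zs Q P} →
             Fresh (vars (dup x x₁ x₂ M) ++ vars N) N ys →
             Fresh (vars (dup x x₁ x₂ M) ++ vars N ++ ys) N zs →
             ES M (renameList (fv N) ys N) x₁ Q →
             ES Q (renameList (fv N) zs N) x₂ P →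
             ES (dup x x₁ x₂ M) N x (dups (fv N) ys zs P)

Subst : Term → Term → ℕ → Term → Set
Subst M N x P = x ∈ fv M × Disjoint (remove x (fv M)) (fv N) × ES M N x P

-- Structural equivalence: least congruence-equivalence containing
-- α-conversion and the four axioms of the paper.

data StrAx : Term → Term → Set where
  α-lam    : ∀ {x y M} → y ∉ fv (lam x M) → StrAx (lam x M) (lam y (swap x y M))
  α-dup    : ∀ {x x₁ x₂ y M} → y ∉ remove x₁ (fv M) →
             StrAx (dup x x₁ x₂ M) (dup x y x₂ (swap x₁ y M))
  era-comm : ∀ {x y M} → StrAx (era x (era y M)) (era y (era x M))
  dup-sym  : ∀ {x x₁ x₂ M} → StrAx (dup x x₁ x₂ M) (dup x x₂ x₁ M)
  dup-asc  : ∀ {x y z u v M} → StrAx (dup x y z (dup y u v M)) (dup x y u (dup y z v M))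
  dup-comm : ∀ {x x₁ x₂ y y₁ y₂ M} → x ≢ y₁ → x ≢ y₂ → y ≢ x₁ → y ≢ x₂ →
             StrAx (dup x x₁ x₂ (dup y y₁ y₂ M)) (dup y y₁ y₂ (dup x x₁ x₂ M))

data Ctx (R : Term → Term → Set) : Term → Term → Set where
  here  : ∀ {M N} → R M N → Ctx R M N
  c-lam : ∀ {x M N} → Ctx R M N → Ctx R (lam x M) (lam x N)
  c-appL : ∀ {M N P} → Ctx R M N → Ctx R (app M P) (app N P)
  c-appR : ∀ {M N P} → Ctx R M N → Ctx R (app P M) (app P N)
  c-era : ∀ {x M N} → Ctx R M N → Ctx R (era x M) (era x N)
  c-dup : ∀ {x x₁ x₂ M N} → Ctx R M N → Ctx R (dup x x₁ x₂ M) (dup x x₁ x₂ N)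

data SymAx : Term → Term → Set where
  fwd : ∀ {M N} → StrAx M N → SymAx M N
  bwd : ∀ {M N} → StrAx N M → SymAx M N

infix 4 _≡ₛ_ _↦_ _⟶_ _↠_

-- relations of the paper live on Λ®: every step is between terms of Λ®
StrStep : Term → Term → Set
StrStep M N = WF M × WF N × Ctx SymAx M N

_≡ₛ_ : Term → Term → Set
_≡ₛ_ = Star StrStep

data _↦_ : Term → Term → Set where
  β     : ∀ {x M N P} → Subst M N x P → app (lam x M) N ↦ P
  γ-lam : ∀ {x x₁ x₂ y M} → y ≢ x →
          dup x x₁ x₂ (lam y M) ↦ lam y (dup x x₁ x₂ M)
  γ-appL : ∀ {x x₁ x₂ M N} → x₁ ∉ fv N → x₂ ∉ fv N →
          dup x x₁ x₂ (app M N) ↦ app (dup x x₁ x₂ M) N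
  γ-appR : ∀ {x x₁ x₂ M N} → x₁ ∉ fv M → x₂ ∉ fv M →
          dup x x₁ x₂ (app M N) ↦ app M (dup x x₁ x₂ N)
  ω-lam : ∀ {x y M} → x ≢ y → lam x (era y M) ↦ era y (lam x M)
  ω-appL : ∀ {x M N} → app (era x M) N ↦ era x (app M N)
  ω-appR : ∀ {x M N} → app M (era x N) ↦ era x (app M N)
  γω    : ∀ {x x₁ x₂ y M} → y ≢ x₁ → y ≢ x₂ →
          dup x x₁ x₂ (era y M) ↦ era y (dup x x₁ x₂ M)
  γω-X  : ∀ {x x₁ x₂ M P} → Subst M (var x) x₂ P →
          dup x x₁ x₂ (era x₁ M) ↦ P

data _⟶_ : Term → Term → Set where
  step : ∀ {M M' N' N} → M ≡ₛ M' → WF M' → Ctx _↦_ M' N' → WF N' → N' ≡ₛ N → M ⟶ N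

_↠_ : Term → Term → Set
_↠_ = Star _⟶_

module Submission where

-- Free variables are computed as lists (fv) and compared as sets (_≈_).  Structural axioms, the γ- and ω-rules
-- only reorder the free variables and rename bound ones; on the lists
-- these are equalities or permutations, built from algebraic laws of
-- `remove` (commutation, distribution over ++, removing absent names).
-- The β-rule and γω-X need the substitution lemma
--   Fv(M⟨N/x⟩) = (Fv(M) ∖ {x}) ∪ Fv(N),
-- proved by induction on the evaluation of the explicit substitution
-- M[N/x], with one lemma per evaluation rule.  The invariant also records
-- well-formedness of the result, which the duplication rule needs: it
-- substitutes two fresh copies of N (fresh renamings, whose free variables
-- are exactly the fresh names) and then duplicates their free variables.
-- Finally, preservation is lifted through contexts, structural
-- equivalence and the reflexive–transitive closure.

open import Defs
open import Data.List.Relation.Binary.BagAndSetEquality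
  using (_∼[_]_; set; [_]-Equality; bag-=⇒; ↭⇒∼bag; ∷-cong; ++-cong)
open import Data.Nat using (ℕ; _≟_; _≡ᵇ_; pred)
open import Data.Bool using (true; false)
open import Data.List using (List; []; _∷_; _++_; map; filter; length)
open import Data.List.Properties using (map-++; map-∘; map-id; map-id-local; filter-++; ++-assoc)
open import Data.List.Membership.Propositional using (_∈_; _∉_)
open import Data.List.Membership.Propositional.Properties
  using (∈-++⁺ˡ; ∈-++⁺ʳ; ∈-++⁻; ∈-map⁺; ∈-map⁻; ∈-filter⁺; ∈-filter⁻)
open import Data.List.Relation.Binary.Subset.Propositional using (_⊆_)
open import Data.List.Relation.Binary.Permutation.Propositional
  using (_↭_; ↭-refl; ↭-prep; ↭-swap; ↭-sym; ↭⇒↭ₛ; module PermutationReasoning)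
open import Data.List.Relation.Binary.Permutation.Propositional.Properties
  using (shift; shifts; ++-comm; ++⁺ˡ)
import Data.List.Relation.Binary.Permutation.Setoid.Properties as Permₛ
open import Data.List.Relation.Unary.Any using (here; there)
open import Data.List.Relation.Unary.All using ([]; tabulate; lookup)
open import Data.List.Relation.Unary.All.Properties using (¬Any⇒All¬; All¬⇒¬Any)
open import Data.List.Relation.Unary.AllPairs using ([]; _∷_)
open import Data.List.Relation.Unary.Unique.Propositional using (Unique)
import Data.List.Relation.Unary.Unique.Propositional.Properties as Unique
open import Data.Product using (_×_; _,_; proj₁)
open import Data.Sum using (_⊎_; inj₁; inj₂)
open import Function using (_∘_; flip)
open import Function.Bundles using (Equivalence; mk⇔)
open import Relation.Nullary using (yes; no; proof; ofʸ; ofⁿ; ¬?; contradiction)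
open import Relation.Binary.Bundles using (Setoid)
open import Relation.Binary.PropositionalEquality
  using (_≡_; _≢_; refl; sym; trans; cong; cong₂; subst; subst₂; setoid; module ≡-Reasoning)
open import Relation.Binary.Construct.Closure.ReflexiveTransitive using (Star; fold)
import Relation.Binary.Reasoning.Setoid

infix 4 _≈_
_≈_ : List ℕ → List ℕ → Set
xs ≈ ys = xs ∼[ set ] ys

open Setoid ([ set ]-Equality ℕ)
  using () renaming (refl to ≈-refl; sym to ≈-sym; trans to ≈-trans; reflexive to ≈-reflexive)
module ≈-Reasoning = Relation.Binary.Reasoning.Setoid ([ set ]-Equality ℕ)

↭⇒≈ : ∀ {xs ys} → xs ↭ ys → xs ≈ ys
↭⇒≈ p = bag-=⇒ (↭⇒∼bag p)

≈⇒⊆ : ∀ {xs ys} → xs ≈ ys → xs ⊆ ys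
≈⇒⊆ e = Equivalence.to e

≈⇒⊇ : ∀ {xs ys} → xs ≈ ys → ys ⊆ xs
≈⇒⊇ e = Equivalence.from e

∈-split : ∀ {xs} as {bs w} → xs ≈ as ++ bs → w ∈ xs → w ∈ as ⊎ w ∈ bs
∈-split as e m = ∈-++⁻ as (≈⇒⊆ e m)

∈-inl : ∀ {xs as bs w} → xs ≈ as ++ bs → w ∈ as → w ∈ xs
∈-inl e m = ≈⇒⊇ e (∈-++⁺ˡ m)

∈-inr : ∀ {xs} as {bs w} → xs ≈ as ++ bs → w ∈ bs → w ∈ xs
∈-inr as e m = ≈⇒⊇ e (∈-++⁺ʳ as m)

disjoint-⊆ˡ : ∀ {xs ys zs : List ℕ} → xs ⊆ ys → Disjoint ys zs → Disjoint xs zs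
disjoint-⊆ˡ xs⊆ys d m = d (xs⊆ys m)

disjoint-++ʳ : ∀ {xs ys zs : List ℕ} → Disjoint xs ys → Disjoint xs zs → Disjoint xs (ys ++ zs)
disjoint-++ʳ {ys = ys} d₁ d₂ m n with ∈-++⁻ ys n
... | inj₁ n₁ = d₁ m n₁
... | inj₂ n₂ = d₂ m n₂

unique-∷ : ∀ {x : ℕ} {xs} → x ∉ xs → Unique xs → Unique (x ∷ xs)
unique-∷ {xs = xs} x∉xs u = ¬Any⇒All¬ xs x∉xs ∷ u

unique-head : ∀ {x : ℕ} {xs} → Unique (x ∷ xs) → x ∉ xs
unique-head = Unique.Unique[x∷xs]⇒x∉xs

unique-++ : ∀ {xs ys : List ℕ} → Unique xs → Unique ys → Disjoint xs ys → Unique (xs ++ ys)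
unique-++ ux uy d = Unique.++⁺ ux uy (λ (m , n) → d m n)

unique-++ʳ : ∀ (xs : List ℕ) {ys} → Unique (xs ++ ys) → Unique ys
unique-++ʳ []       u       = u
unique-++ʳ (_ ∷ xs) (_ ∷ u) = unique-++ʳ xs u

unique-++-disjoint : ∀ (xs : List ℕ) {ys} → Unique (xs ++ ys) → Disjoint xs ys
unique-++-disjoint (x ∷ xs) u (here refl) n = unique-head u (∈-++⁺ʳ xs n)
unique-++-disjoint (x ∷ xs) (_ ∷ u) (there m) n = unique-++-disjoint xs u m n

unique-resp-↭ : ∀ {xs ys : List ℕ} → xs ↭ ys → Unique xs → Unique ys
unique-resp-↭ p = Permₛ.Unique-resp-↭ (setoid ℕ) (↭⇒↭ₛ p)

-- `remove x` is the filter keeping everything different from x; this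
-- gives membership and uniqueness facts for free.
remove≡filter : ∀ x l → remove x l ≡ filter (λ y → ¬? (x ≟ y)) l
remove≡filter x []      = refl
remove≡filter x (y ∷ l) with x ≡ᵇ y
... | true  = remove≡filter x l
... | false = cong (y ∷_) (remove≡filter x l)

∈-remove⁺ : ∀ {w x l} → w ∈ l → w ≢ x → w ∈ remove x l
∈-remove⁺ {w} {x} {l} m w≢x =
  subst (w ∈_) (sym (remove≡filter x l)) (∈-filter⁺ (λ y → ¬? (x ≟ y)) m (w≢x ∘ sym))

∈-remove⁻ : ∀ {w x l} → w ∈ remove x l → w ∈ l × w ≢ x
∈-remove⁻ {w} {x} {l} m with ∈-filter⁻ (λ y → ¬? (x ≟ y)) (subst (w ∈_) (remove≡filter x l) m)
... | m′ , x≢w = m′ , x≢w ∘ sym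

remove-sub : ∀ {x l} → remove x l ⊆ l
remove-sub = proj₁ ∘ ∈-remove⁻

remove-⊆ : ∀ {x xs ys} → xs ⊆ ys → remove x xs ⊆ remove x ys
remove-⊆ xs⊆ys m with ∈-remove⁻ m
... | m′ , w≢x = ∈-remove⁺ (xs⊆ys m′) w≢x

remove-cong : ∀ {x xs ys} → xs ≈ ys → remove x xs ≈ remove x ys
remove-cong e = mk⇔ (remove-⊆ (≈⇒⊆ e)) (remove-⊆ (≈⇒⊇ e))

remove-head : ∀ x l → remove x (x ∷ l) ≡ remove x l
remove-head x l with x ≡ᵇ x | proof (x ≟ x)
... | true  | _        = refl
... | false | ofⁿ x≢x = contradiction refl x≢x

remove-skip : ∀ {x y} l → x ≢ y → remove x (y ∷ l) ≡ y ∷ remove x l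
remove-skip {x} {y} l x≢y with x ≡ᵇ y | proof (x ≟ y)
... | true  | ofʸ x≡y = contradiction x≡y x≢y
... | false | _        = refl

remove-∉ : ∀ {x l} → x ∉ l → remove x l ≡ l
remove-∉ {l = []}    _   = refl
remove-∉ {l = y ∷ l} x∉l =
  trans (remove-skip l (x∉l ∘ here)) (cong (y ∷_) (remove-∉ (x∉l ∘ there)))

remove-++ : ∀ x l m → remove x (l ++ m) ≡ remove x l ++ remove x m
remove-++ x l m
  rewrite remove≡filter x (l ++ m) | remove≡filter x l | remove≡filter x m =
  filter-++ (λ y → ¬? (x ≟ y)) l m

remove-comm : ∀ x y l → remove x (remove y l) ≡ remove y (remove x l)
remove-comm x y []      = refl
remove-comm x y (z ∷ l) with x ≟ z | y ≟ z
... | yes refl | yes refl = refl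
... | yes refl | no y≢z = begin
  remove z (remove y (z ∷ l))  ≡⟨ cong (remove z) (remove-skip l y≢z) ⟩
  remove z (z ∷ remove y l)    ≡⟨ remove-head z (remove y l) ⟩
  remove z (remove y l)        ≡⟨ remove-comm z y l ⟩
  remove y (remove z l)        ≡⟨ cong (remove y) (remove-head z l) ⟨
  remove y (remove z (z ∷ l))  ∎
  where open ≡-Reasoning
... | no x≢z | yes refl = begin
  remove x (remove z (z ∷ l))  ≡⟨ cong (remove x) (remove-head z l) ⟩
  remove x (remove z l)        ≡⟨ remove-comm x z l ⟩
  remove z (remove x l)        ≡⟨ remove-head z (remove x l) ⟨
  remove z (z ∷ remove x l)    ≡⟨ cong (remove z) (remove-skip l x≢z) ⟨
  remove z (remove x (z ∷ l))  ∎
  where open ≡-Reasoning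
... | no x≢z | no y≢z = begin
  remove x (remove y (z ∷ l))  ≡⟨ cong (remove x) (remove-skip l y≢z) ⟩
  remove x (z ∷ remove y l)    ≡⟨ remove-skip (remove y l) x≢z ⟩
  z ∷ remove x (remove y l)    ≡⟨ cong (z ∷_) (remove-comm x y l) ⟩
  z ∷ remove y (remove x l)    ≡⟨ remove-skip (remove x l) y≢z ⟨
  remove y (z ∷ remove x l)    ≡⟨ cong (remove y) (remove-skip l x≢z) ⟨
  remove y (remove x (z ∷ l))  ∎
  where open ≡-Reasoning

remove-map : ∀ {f : ℕ → ℕ} → (∀ {u v} → f u ≡ f v → u ≡ v) →
             ∀ z l → remove (f z) (map f l) ≡ map f (remove z l)
remove-map f-inj z []      = refl
remove-map {f} f-inj z (y ∷ l) with z ≟ y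
... | yes refl = begin
  remove (f z) (f z ∷ map f l)  ≡⟨ remove-head (f z) (map f l) ⟩
  remove (f z) (map f l)        ≡⟨ remove-map f-inj z l ⟩
  map f (remove z l)            ≡⟨ cong (map f) (remove-head z l) ⟨
  map f (remove z (z ∷ l))      ∎
  where open ≡-Reasoning
... | no z≢y = begin
  remove (f z) (f y ∷ map f l)  ≡⟨ remove-skip (map f l) (z≢y ∘ f-inj) ⟩
  f y ∷ remove (f z) (map f l)  ≡⟨ cong (f y ∷_) (remove-map f-inj z l) ⟩
  f y ∷ map f (remove z l)      ≡⟨ cong (map f) (remove-skip l z≢y) ⟨
  map f (remove z (y ∷ l))      ∎
  where open ≡-Reasoning

unique-remove : ∀ {x l} → Unique l → Unique (remove x l)
unique-remove {x} {l} u =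
  subst Unique (sym (remove≡filter x l)) (Unique.filter⁺ (λ y → ¬? (x ≟ y)) u)

-- Fv(x <^{x₁}_{x₂} M) = {x} ∪ remove₂ x₁ x₂ (Fv(M)), definitionally.
remove₂ : ℕ → ℕ → List ℕ → List ℕ
remove₂ x₁ x₂ l = remove x₂ (remove x₁ l)

∈-remove₂⁺ : ∀ {w x₁ x₂ l} → w ∈ l → w ≢ x₁ → w ≢ x₂ → w ∈ remove₂ x₁ x₂ l
∈-remove₂⁺ m w≢x₁ w≢x₂ = ∈-remove⁺ (∈-remove⁺ m w≢x₁) w≢x₂

remove₂-sub : ∀ {x₁ x₂ l} → remove₂ x₁ x₂ l ⊆ l
remove₂-sub = remove-sub ∘ remove-sub

remove₂-cong : ∀ {x₁ x₂ xs ys} → xs ≈ ys → remove₂ x₁ x₂ xs ≈ remove₂ x₁ x₂ ys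
remove₂-cong = remove-cong ∘ remove-cong

remove₂-++ : ∀ x₁ x₂ l m → remove₂ x₁ x₂ (l ++ m) ≡ remove₂ x₁ x₂ l ++ remove₂ x₁ x₂ m
remove₂-++ x₁ x₂ l m =
  trans (cong (remove x₂) (remove-++ x₁ l m)) (remove-++ x₂ (remove x₁ l) (remove x₁ m))

remove₂-∉ : ∀ {x₁ x₂ l} → x₁ ∉ l → x₂ ∉ l → remove₂ x₁ x₂ l ≡ l
remove₂-∉ x₁∉l x₂∉l = trans (cong (remove _) (remove-∉ x₁∉l)) (remove-∉ x₂∉l)

remove₂-skip : ∀ {x₁ x₂ y} l → x₁ ≢ y → x₂ ≢ y → remove₂ x₁ x₂ (y ∷ l) ≡ y ∷ remove₂ x₁ x₂ l
remove₂-skip l x₁≢y x₂≢y =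
  trans (cong (remove _) (remove-skip l x₁≢y)) (remove-skip (remove _ l) x₂≢y)

remove₂-own : ∀ {b c S} → b ≢ c → b ∉ S → c ∉ S → remove₂ b c (b ∷ c ∷ S) ≡ S
remove₂-own {b} {c} {S} b≢c b∉S c∉S = begin
  remove c (remove b (b ∷ c ∷ S))  ≡⟨ cong (remove c) (remove-head b (c ∷ S)) ⟩
  remove c (remove b (c ∷ S))      ≡⟨ cong (remove c) (remove-skip S b≢c) ⟩
  remove c (c ∷ remove b S)        ≡⟨ remove-head c (remove b S) ⟩
  remove c (remove b S)            ≡⟨ remove₂-∉ b∉S c∉S ⟩
  S                                ∎
  where open ≡-Reasoning

remove-under₂ : ∀ x x₁ x₂ l → remove x (remove₂ x₁ x₂ l) ≡ remove₂ x₁ x₂ (remove x l)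
remove-under₂ x x₁ x₂ l =
  trans (remove-comm x x₂ (remove x₁ l)) (cong (remove x₂) (remove-comm x x₁ l))

remove₂-comm : ∀ x₁ x₂ y₁ y₂ l →
               remove₂ x₁ x₂ (remove₂ y₁ y₂ l) ≡ remove₂ y₁ y₂ (remove₂ x₁ x₂ l)
remove₂-comm x₁ x₂ y₁ y₂ l =
  trans (cong (remove x₂) (remove-under₂ x₁ y₁ y₂ l)) (remove-under₂ x₂ y₁ y₂ (remove x₁ l))

-- Name swapping

swapV-left : ∀ a b → swapV a b a ≡ b
swapV-left a b with a ≡ᵇ a | proof (a ≟ a)
... | true  | _        = refl
... | false | ofⁿ a≢a = contradiction refl a≢a

swapV-right : ∀ a b → swapV a b b ≡ a
swapV-right a b with b ≡ᵇ a | proof (b ≟ a)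
... | true  | ofʸ b≡a = b≡a
... | false | _ with b ≡ᵇ b | proof (b ≟ b)
...   | true  | _        = refl
...   | false | ofⁿ b≢b = contradiction refl b≢b

swapV-other : ∀ {a b x} → x ≢ a → x ≢ b → swapV a b x ≡ x
swapV-other {a} {b} {x} x≢a x≢b with x ≡ᵇ a | proof (x ≟ a)
... | true  | ofʸ x≡a = contradiction x≡a x≢a
... | false | _ with x ≡ᵇ b | proof (x ≟ b)
...   | true  | ofʸ x≡b = contradiction x≡b x≢b
...   | false | _        = refl

swapV-involutive : ∀ a b x → swapV a b (swapV a b x) ≡ x
swapV-involutive a b x with x ≟ a | x ≟ b
... | yes refl | _ = trans (cong (swapV a b) (swapV-left a b)) (swapV-right a b)
... | no _ | yes refl = trans (cong (swapV a b) (swapV-right a b)) (swapV-left a b)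
... | no x≢a | no x≢b =
  trans (cong (swapV a b) (swapV-other x≢a x≢b)) (swapV-other x≢a x≢b)

swapV-injective : ∀ a b {x y} → swapV a b x ≡ swapV a b y → x ≡ y
swapV-injective a b {x} {y} e =
  trans (sym (swapV-involutive a b x)) (trans (cong (swapV a b) e) (swapV-involutive a b y))

∈-map-injective⁻ : ∀ {f : ℕ → ℕ} → (∀ {u v} → f u ≡ f v → u ≡ v) →
                   ∀ {x l} → f x ∈ map f l → x ∈ l
∈-map-injective⁻ f-inj m with ∈-map⁻ _ m
... | _ , m′ , fx≡fy = subst (_∈ _) (sym (f-inj fx≡fy)) m′

fv-swap : ∀ a b M → fv (swap a b M) ≡ map (swapV a b) (fv M)
fv-swap a b (var x) = refl
fv-swap a b (lam x M) =
  trans (cong (remove _) (fv-swap a b M)) (remove-map (swapV-injective a b) x (fv M))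
fv-swap a b (app M N) =
  trans (cong₂ _++_ (fv-swap a b M) (fv-swap a b N)) (sym (map-++ (swapV a b) (fv M) (fv N)))
fv-swap a b (era x M) = cong (swapV a b x ∷_) (fv-swap a b M)
fv-swap a b (dup x x₁ x₂ M) = cong (swapV a b x ∷_) (begin
  remove₂ (swapV a b x₁) (swapV a b x₂) (fv (swap a b M))
    ≡⟨ cong (remove₂ _ _) (fv-swap a b M) ⟩
  remove₂ (swapV a b x₁) (swapV a b x₂) (map (swapV a b) (fv M))
    ≡⟨ cong (remove _) (remove-map (swapV-injective a b) x₁ (fv M)) ⟩
  remove (swapV a b x₂) (map (swapV a b) (remove x₁ (fv M)))
    ≡⟨ remove-map (swapV-injective a b) x₂ (remove x₁ (fv M)) ⟩
  map (swapV a b) (remove₂ x₁ x₂ (fv M))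
    ∎)
  where open ≡-Reasoning

wf-swap : ∀ a b {M} → WF M → WF (swap a b M)
wf-swap a b = go
  where
  σ : ℕ → ℕ
  σ = swapV a b
  σ-inj : ∀ {u v} → σ u ≡ σ v → u ≡ v
  σ-inj = swapV-injective a b

  ∈-σ : ∀ {x} N → x ∈ fv N → σ x ∈ fv (swap a b N)
  ∈-σ N m = subst (_ ∈_) (sym (fv-swap a b N)) (∈-map⁺ σ m)

  ∈-σ⁻ : ∀ {x} N → σ x ∈ fv (swap a b N) → x ∈ fv N
  ∈-σ⁻ N m = ∈-map-injective⁻ σ-inj (subst (_ ∈_) (fv-swap a b N) m)

  go : ∀ {N} → WF N → WF (swap a b N)
  go wf-var = wf-var
  go (wf-lam {M = N} w x∈N) = wf-lam (go w) (∈-σ N x∈N)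
  go (wf-app {M = N₁} {N = N₂} w₁ w₂ d) = wf-app (go w₁) (go w₂) d′
    where
    d′ : Disjoint (fv (swap a b N₁)) (fv (swap a b N₂))
    d′ m n with ∈-map⁻ σ (subst (_ ∈_) (fv-swap a b N₁) m)
    ... | _ , m′ , refl = d m′ (∈-σ⁻ N₂ n)
  go (wf-era {M = N} w x∉N) = wf-era (go w) (x∉N ∘ ∈-σ⁻ N)
  go (wf-dup {x₁ = x₁} {x₂} {M = N} w x₁∈N x₂∈N x₁≢x₂ x∉R) =
    -- the free variables of λx₂.λx₁.N are those of N bar x₁, x₂
    wf-dup (go w) (∈-σ N x₁∈N) (∈-σ N x₂∈N) (x₁≢x₂ ∘ σ-inj) (x∉R ∘ ∈-σ⁻ (lam x₂ (lam x₁ N)))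

renameV : List ℕ → List ℕ → ℕ → ℕ
renameV (a ∷ as) (b ∷ bs) w = swapV a b (renameV as bs w)
renameV _        _        w = w

fv-rename : ∀ as bs N → fv (renameList as bs N) ≡ map (renameV as bs) (fv N)
fv-rename []       _        N = sym (map-id (fv N))
fv-rename (_ ∷ _)  []       N = sym (map-id (fv N))
fv-rename (a ∷ as) (b ∷ bs) N = begin
  fv (swap a b (renameList as bs N))            ≡⟨ fv-swap a b (renameList as bs N) ⟩
  map (swapV a b) (fv (renameList as bs N))     ≡⟨ cong (map (swapV a b)) (fv-rename as bs N) ⟩
  map (swapV a b) (map (renameV as bs) (fv N))  ≡⟨ map-∘ (fv N) ⟨
  map (swapV a b ∘ renameV as bs) (fv N)        ∎
  where open ≡-Reasoning

wf-rename : ∀ as bs {N} → WF N → WF (renameList as bs N)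
wf-rename []       _        w = w
wf-rename (_ ∷ _)  []       w = w
wf-rename (a ∷ as) (b ∷ bs) w = wf-swap a b (wf-rename as bs w)

renameV-fix : ∀ as bs {w} → w ∉ as → w ∉ bs → renameV as bs w ≡ w
renameV-fix []       _        _    _    = refl
renameV-fix (_ ∷ _)  []       _    _    = refl
renameV-fix (a ∷ as) (b ∷ bs) w∉as w∉bs =
  trans (cong (swapV a b) (renameV-fix as bs (w∉as ∘ there) (w∉bs ∘ there)))
        (swapV-other (w∉as ∘ here) (w∉bs ∘ here))

renameV-sends : ∀ as bs → Unique as → Unique bs → length as ≡ length bs → Disjoint as bs →
                map (renameV as bs) as ≡ bs
renameV-sends []       []       _        _        _     _ = refl
renameV-sends (a ∷ as) (b ∷ bs) (a≢as ∷ ua) (b≢bs ∷ ub) |as|≡|bs| d = cong₂ _∷_ a↦b as↦bs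
  where
  a↦b : swapV a b (renameV as bs a) ≡ b
  a↦b = trans (cong (swapV a b) (renameV-fix as bs (All¬⇒¬Any a≢as) (d (here refl) ∘ there)))
              (swapV-left a b)
  as↦bs : map (swapV a b ∘ renameV as bs) as ≡ bs
  as↦bs = begin
    map (swapV a b ∘ renameV as bs) as          ≡⟨ map-∘ as ⟩
    map (swapV a b) (map (renameV as bs) as)    ≡⟨ cong (map (swapV a b)) IH ⟩
    map (swapV a b) bs                          ≡⟨ map-id-local (tabulate fixed) ⟩
    bs                                          ∎
    where
    open ≡-Reasoning
    IH : map (renameV as bs) as ≡ bs
    IH = renameV-sends as bs ua ub (cong pred |as|≡|bs|) (λ m n → d (there m) (there n))
    fixed : ∀ {z} → z ∈ bs → swapV a b z ≡ z
    fixed z∈bs = swapV-other (λ { refl → d (here refl) (there z∈bs) })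
                             (λ { refl → lookup b≢bs z∈bs refl })

unique-fv : ∀ {M} → WF M → Unique (fv M)
unique-fv wf-var                    = [] ∷ []
unique-fv (wf-lam w _)              = unique-remove (unique-fv w)
unique-fv (wf-app w₁ w₂ d)          = unique-++ (unique-fv w₁) (unique-fv w₂) d
unique-fv (wf-era w x∉M)            = unique-∷ x∉M (unique-fv w)
unique-fv (wf-dup w _ _ _ x∉R)      = unique-∷ x∉R (unique-remove (unique-remove (unique-fv w)))

-- Free variables are among all variables, so names fresh for `vars`
-- are fresh for `fv`.
fv⊆vars : ∀ M → fv M ⊆ vars M
fv⊆vars (var x)         m         = m
fv⊆vars (lam x M)       m         = there (fv⊆vars M (remove-sub m))
fv⊆vars (app M N)       m with ∈-++⁻ (fv M) m
... | inj₁ m′ = ∈-++⁺ˡ (fv⊆vars M m′)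
... | inj₂ n  = ∈-++⁺ʳ (vars M) (fv⊆vars N n)
fv⊆vars (era x M)       (here e)  = here e
fv⊆vars (era x M)       (there m) = there (fv⊆vars M m)
fv⊆vars (dup x x₁ x₂ M) (here e)  = here e
fv⊆vars (dup x x₁ x₂ M) (there m) = there (there (there (fv⊆vars M (remove₂-sub m))))

fv-rename-fresh : ∀ {N ys} → WF N → Unique ys → length ys ≡ length (fv N) →
                  Disjoint (fv N) ys → fv (renameList (fv N) ys N) ≡ ys
fv-rename-fresh {N} {ys} wN uys |ys|≡|N| d =
  trans (fv-rename (fv N) ys N) (renameV-sends (fv N) ys (unique-fv wN) uys (sym |ys|≡|N|) d)

-- Iterated erasure and duplication

record HasFv (P : Term) (S : List ℕ) : Set where
  constructor hasFv
  field
    wf    : WF P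
    fv-eq : fv P ≈ S

fv-eras : ∀ xs M → fv (eras xs M) ≡ xs ++ fv M
fv-eras []       M = refl
fv-eras (x ∷ xs) M = cong (x ∷_) (fv-eras xs M)

wf-eras : ∀ xs {M} → WF M → Unique (xs ++ fv M) → WF (eras xs M)
wf-eras []       w _              = w
wf-eras (x ∷ xs) {M} w (x∉ ∷ u) =
  wf-era (wf-eras xs w u) (All¬⇒¬Any x∉ ∘ subst (x ∈_) (fv-eras xs M))

rotate-pair : ∀ b c bs cs (S : List ℕ) → b ∷ bs ++ c ∷ cs ++ S ↭ bs ++ cs ++ b ∷ c ∷ S
rotate-pair b c bs cs S = begin
  b ∷ bs ++ c ∷ cs ++ S          ↭⟨ ↭-prep b (shift c bs (cs ++ S)) ⟩
  b ∷ c ∷ bs ++ cs ++ S          ≡⟨ cong (λ l → b ∷ c ∷ l) (++-assoc bs cs S) ⟨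
  (b ∷ c ∷ []) ++ (bs ++ cs) ++ S ↭⟨ shifts (b ∷ c ∷ []) (bs ++ cs) ⟩
  (bs ++ cs) ++ b ∷ c ∷ S        ≡⟨ ++-assoc bs cs (b ∷ c ∷ S) ⟩
  bs ++ cs ++ b ∷ c ∷ S          ∎
  where open PermutationReasoning

dups-fv : ∀ as bs cs {S P} → length as ≡ length bs → length as ≡ length cs →
          Unique (as ++ bs ++ cs ++ S) → HasFv P (bs ++ cs ++ S) → HasFv (dups as bs cs P) (as ++ S)
dups-fv []       []       []       _  _  _ P-ok = P-ok
dups-fv []       (_ ∷ _)  _        () _  _ _
dups-fv []       []       (_ ∷ _)  _  () _ _
dups-fv (_ ∷ _)  []       _        () _  _ _
dups-fv (_ ∷ _)  (_ ∷ _)  []       _  () _ _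
dups-fv (a ∷ as) (b ∷ bs) (c ∷ cs) {S} {P} |as|≡|bs| |as|≡|cs| (a∉ ∷ u) (hasFv wP eP) =
  hasFv (wf-dup wD (b∈ (here refl)) (b∈ (there (here refl))) b≢c a∉R) (∷-cong refl eR)
  where
  π : b ∷ bs ++ c ∷ cs ++ S ↭ bs ++ cs ++ b ∷ c ∷ S
  π = rotate-pair b c bs cs S
  open HasFv (dups-fv as bs cs (cong pred |as|≡|bs|) (cong pred |as|≡|cs|)
                      (unique-resp-↭ (++⁺ˡ as π) u) (hasFv wP (≈-trans eP (↭⇒≈ π))))
    renaming (wf to wD; fv-eq to eD)
  b∈ : b ∷ c ∷ S ⊆ fv (dups as bs cs P)
  b∈ = ∈-inr as eD
  as#rest : Disjoint as (b ∷ bs ++ c ∷ cs ++ S)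
  as#rest = unique-++-disjoint as u
  u-rest : Unique (b ∷ bs ++ c ∷ cs ++ S)
  u-rest = unique-++ʳ as u
  b∉as : b ∉ as
  b∉as m = as#rest m (here refl)
  c∉as : c ∉ as
  c∉as m = as#rest m (there (∈-++⁺ʳ bs (here refl)))
  b≢c : b ≢ c
  b≢c refl = unique-head u-rest (∈-++⁺ʳ bs (here refl))
  b∉S : b ∉ S
  b∉S m = unique-head u-rest (∈-++⁺ʳ bs (there (∈-++⁺ʳ cs m)))
  c∉S : c ∉ S
  c∉S m = unique-head (unique-++ʳ (b ∷ bs) u-rest) (∈-++⁺ʳ cs m)
  eR : remove₂ b c (fv (dups as bs cs P)) ≈ as ++ S
  eR = begin
    remove₂ b c (fv (dups as bs cs P))  ≈⟨ remove₂-cong eD ⟩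
    remove₂ b c (as ++ b ∷ c ∷ S)       ≡⟨ remove₂-++ b c as (b ∷ c ∷ S) ⟩
    remove₂ b c as ++ remove₂ b c (b ∷ c ∷ S)
      ≡⟨ cong₂ _++_ (remove₂-∉ b∉as c∉as) (remove₂-own b≢c b∉S c∉S) ⟩
    as ++ S                             ∎
    where open ≈-Reasoning
  a∉R : a ∉ remove₂ b c (fv (dups as bs cs P))
  a∉R m with ∈-split as eR m
  ... | inj₁ m′ = All¬⇒¬Any a∉ (∈-++⁺ˡ m′)
  ... | inj₂ n  = All¬⇒¬Any a∉ (∈-++⁺ʳ as (there (∈-++⁺ʳ bs (there (∈-++⁺ʳ cs n)))))

-- The substitution lemma: Fv(M⟨N/x⟩) = (Fv(M) ∖ {x}) ∪ Fv(N)

SubstFv : Term → Term → ℕ → Term → Set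
SubstFv M N x P = WF M → WF N → x ∈ fv M → Disjoint (remove x (fv M)) (fv N) →
                  HasFv P (remove x (fv M) ++ fv N)

subst-var : ∀ {x N} → SubstFv (var x) N x N
subst-var {x} {N} _ wN _ _ = hasFv wN (≈-reflexive (cong (_++ fv N) (sym (remove-head x []))))

subst-lam : ∀ {x y M N P} → y ≢ x → y ∉ fv N → SubstFv M N x P →
            SubstFv (lam y M) N x (lam y P)
subst-lam {x} {y} {M} {N} {P} y≢x y∉N ih (wf-lam wM y∈M) wN x∈λ d =
  hasFv (wf-lam wP (∈-inl eP (∈-remove⁺ y∈M y≢x))) eq
  where
  d′ : Disjoint (remove x (fv M)) (fv N)
  d′ {w} m n with w ≟ y
  ... | yes refl = y∉N n
  ... | no w≢y   = d (subst (w ∈_) (remove-comm y x (fv M)) (∈-remove⁺ m w≢y)) n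
  open HasFv (ih wM wN (remove-sub x∈λ) d′) renaming (wf to wP; fv-eq to eP)
  eq : remove y (fv P) ≈ remove x (remove y (fv M)) ++ fv N
  eq = begin
    remove y (fv P)                              ≈⟨ remove-cong eP ⟩
    remove y (remove x (fv M) ++ fv N)           ≡⟨ remove-++ y (remove x (fv M)) (fv N) ⟩
    remove y (remove x (fv M)) ++ remove y (fv N)
      ≡⟨ cong₂ _++_ (remove-comm y x (fv M)) (remove-∉ y∉N) ⟩
    remove x (remove y (fv M)) ++ fv N           ∎
    where open ≈-Reasoning

subst-appL : ∀ {x M Q N P} → x ∈ fv M → SubstFv M N x P → SubstFv (app M Q) N x (app P Q)
subst-appL {x} {M} {Q} {N} {P} x∈M ih (wf-app wM wQ dMQ) wN _ d = hasFv (wf-app wP wQ dPQ) eq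
  where
  x∉Q : x ∉ fv Q
  x∉Q = dMQ x∈M
  open HasFv (ih wM wN x∈M (disjoint-⊆ˡ (remove-⊆ {x} {fv M} ∈-++⁺ˡ) d))
    renaming (wf to wP; fv-eq to eP)
  dPQ : Disjoint (fv P) (fv Q)
  dPQ p q with ∈-split (remove x (fv M)) eP p
  ... | inj₁ m = dMQ (remove-sub m) q
  ... | inj₂ n = d (∈-remove⁺ (∈-++⁺ʳ (fv M) q) (λ { refl → x∉Q q })) n
  eq : fv P ++ fv Q ≈ remove x (fv M ++ fv Q) ++ fv N
  eq = begin
    fv P ++ fv Q                          ≈⟨ ++-cong eP ≈-refl ⟩
    (remove x (fv M) ++ fv N) ++ fv Q     ≡⟨ ++-assoc (remove x (fv M)) (fv N) (fv Q) ⟩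
    remove x (fv M) ++ fv N ++ fv Q       ≈⟨ ↭⇒≈ (++⁺ˡ (remove x (fv M)) (++-comm (fv N) (fv Q))) ⟩
    remove x (fv M) ++ fv Q ++ fv N       ≡⟨ ++-assoc (remove x (fv M)) (fv Q) (fv N) ⟨
    (remove x (fv M) ++ fv Q) ++ fv N
      ≡⟨ cong (λ l → (remove x (fv M) ++ l) ++ fv N) (remove-∉ x∉Q) ⟨
    (remove x (fv M) ++ remove x (fv Q)) ++ fv N ≡⟨ cong (_++ fv N) (remove-++ x (fv M) (fv Q)) ⟨
    remove x (fv M ++ fv Q) ++ fv N       ∎
    where open ≈-Reasoning

subst-appR : ∀ {x M Q N P} → x ∈ fv Q → SubstFv Q N x P → SubstFv (app M Q) N x (app M P)
subst-appR {x} {M} {Q} {N} {P} x∈Q ih (wf-app wM wQ dMQ) wN _ d = hasFv (wf-app wM wP dMP) eq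
  where
  x∉M : x ∉ fv M
  x∉M m = dMQ m x∈Q
  open HasFv (ih wQ wN x∈Q (disjoint-⊆ˡ (remove-⊆ {x} {fv Q} (∈-++⁺ʳ (fv M))) d))
    renaming (wf to wP; fv-eq to eP)
  dMP : Disjoint (fv M) (fv P)
  dMP m p with ∈-split (remove x (fv Q)) eP p
  ... | inj₁ q = dMQ m (remove-sub q)
  ... | inj₂ n = d (∈-remove⁺ (∈-++⁺ˡ m) (λ { refl → x∉M m })) n
  eq : fv M ++ fv P ≈ remove x (fv M ++ fv Q) ++ fv N
  eq = begin
    fv M ++ fv P                          ≈⟨ ++-cong (≈-refl {fv M}) eP ⟩
    fv M ++ remove x (fv Q) ++ fv N       ≡⟨ ++-assoc (fv M) (remove x (fv Q)) (fv N) ⟨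
    (fv M ++ remove x (fv Q)) ++ fv N
      ≡⟨ cong (λ l → (l ++ remove x (fv Q)) ++ fv N) (remove-∉ x∉M) ⟨
    (remove x (fv M) ++ remove x (fv Q)) ++ fv N ≡⟨ cong (_++ fv N) (remove-++ x (fv M) (fv Q)) ⟨
    remove x (fv M ++ fv Q) ++ fv N       ∎
    where open ≈-Reasoning

subst-era : ∀ {x y M N P} → y ≢ x → SubstFv M N x P → SubstFv (era y M) N x (era y P)
subst-era {x} {y} {M} {N} {P} y≢x ih (wf-era wM y∉M) wN x∈yM d = hasFv (wf-era wP y∉P) eq
  where
  x∈M : x ∈ y ∷ fv M → x ∈ fv M
  x∈M (here x≡y) = contradiction (sym x≡y) y≢x
  x∈M (there m)  = m
  open HasFv (ih wM wN (x∈M x∈yM) (disjoint-⊆ˡ (remove-⊆ {x} {fv M} there) d))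
    renaming (wf to wP; fv-eq to eP)
  y∉P : y ∉ fv P
  y∉P p with ∈-split (remove x (fv M)) eP p
  ... | inj₁ m = y∉M (remove-sub m)
  ... | inj₂ n = d (∈-remove⁺ {l = y ∷ fv M} (here refl) y≢x) n
  eq : y ∷ fv P ≈ remove x (y ∷ fv M) ++ fv N
  eq = begin
    y ∷ fv P                        ≈⟨ ∷-cong refl eP ⟩
    y ∷ remove x (fv M) ++ fv N     ≡⟨ cong (_++ fv N) (remove-skip (fv M) (y≢x ∘ sym)) ⟨
    remove x (y ∷ fv M) ++ fv N     ∎
    where open ≈-Reasoning

subst-eraX : ∀ {x M N} → SubstFv (era x M) N x (eras (fv N) M)
subst-eraX {x} {M} {N} (wf-era wM x∉M) wN _ d = hasFv (wf-eras (fv N) wM uNM) eq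
  where
  x-free : remove x (x ∷ fv M) ≡ fv M
  x-free = trans (remove-head x (fv M)) (remove-∉ x∉M)
  uNM : Unique (fv N ++ fv M)
  uNM = unique-++ (unique-fv wN) (unique-fv wM) (λ n m → d (subst (_ ∈_) (sym x-free) m) n)
  eq : fv (eras (fv N) M) ≈ remove x (x ∷ fv M) ++ fv N
  eq = begin
    fv (eras (fv N) M)               ≡⟨ fv-eras (fv N) M ⟩
    fv N ++ fv M                     ≈⟨ ↭⇒≈ (++-comm (fv N) (fv M)) ⟩
    fv M ++ fv N                     ≡⟨ cong (_++ fv N) x-free ⟨
    remove x (x ∷ fv M) ++ fv N      ∎
    where open ≈-Reasoning

subst-dup : ∀ {x y y₁ y₂ M N P} → y ≢ x → y₁ ≢ x → y₂ ≢ x → y₁ ∉ fv N → y₂ ∉ fv N →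
            SubstFv M N x P → SubstFv (dup y y₁ y₂ M) N x (dup y y₁ y₂ P)
subst-dup {x} {y} {y₁} {y₂} {M} {N} {P} y≢x y₁≢x y₂≢x y₁∉N y₂∉N ih
          (wf-dup wM y₁∈M y₂∈M y₁≢y₂ y∉R) wN x∈ d =
  hasFv (wf-dup wP (∈P y₁∈M y₁≢x) (∈P y₂∈M y₂≢x) y₁≢y₂ y∉RP) eq
  where
  R : List ℕ
  R = remove₂ y₁ y₂ (fv M)
  x∈M : x ∈ y ∷ R → x ∈ fv M
  x∈M (here x≡y) = contradiction (sym x≡y) y≢x
  x∈M (there m)  = remove₂-sub m
  -- the bound names y₁, y₂ are not free in N
  d′ : Disjoint (remove x (fv M)) (fv N)
  d′ {w} m n with w ≟ y₁ | w ≟ y₂ | ∈-remove⁻ {l = fv M} m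
  ... | yes refl | _        | _ = y₁∉N n
  ... | no _     | yes refl | _ = y₂∉N n
  ... | no w≢y₁  | no w≢y₂  | m′ , w≢x =
    d (∈-remove⁺ {l = y ∷ R} (there (∈-remove₂⁺ m′ w≢y₁ w≢y₂)) w≢x) n
  open HasFv (ih wM wN (x∈M x∈) d′) renaming (wf to wP; fv-eq to eP)
  ∈P : ∀ {w} → w ∈ fv M → w ≢ x → w ∈ fv P
  ∈P m w≢x = ∈-inl eP (∈-remove⁺ m w≢x)
  eR : remove₂ y₁ y₂ (fv P) ≈ remove x R ++ fv N
  eR = begin
    remove₂ y₁ y₂ (fv P)                                    ≈⟨ remove₂-cong eP ⟩
    remove₂ y₁ y₂ (remove x (fv M) ++ fv N)
      ≡⟨ remove₂-++ y₁ y₂ (remove x (fv M)) (fv N) ⟩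
    remove₂ y₁ y₂ (remove x (fv M)) ++ remove₂ y₁ y₂ (fv N)
      ≡⟨ cong₂ _++_ (sym (remove-under₂ x y₁ y₂ (fv M)))
                                                                         (remove₂-∉ y₁∉N y₂∉N) ⟩
    remove x R ++ fv N                                      ∎
    where open ≈-Reasoning
  y∉RP : y ∉ remove₂ y₁ y₂ (fv P)
  y∉RP p with ∈-split (remove x R) eR p
  ... | inj₁ m = y∉R (remove-sub m)
  ... | inj₂ n = d (∈-remove⁺ {l = y ∷ R} (here refl) y≢x) n
  eq : y ∷ remove₂ y₁ y₂ (fv P) ≈ remove x (y ∷ R) ++ fv N
  eq = begin
    y ∷ remove₂ y₁ y₂ (fv P)   ≈⟨ ∷-cong refl eR ⟩
    y ∷ remove x R ++ fv N     ≡⟨ cong (_++ fv N) (remove-skip R (y≢x ∘ sym)) ⟨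
    remove x (y ∷ R) ++ fv N   ∎
    where open ≈-Reasoning

subst-both : ∀ {x₁ x₂ M N₁ N₂ Q P} → WF M → WF N₁ → WF N₂ → x₁ ∈ fv M → x₂ ∈ fv M → x₁ ≢ x₂ →
             Disjoint (fv N₁) (fv M) → Disjoint (fv N₂) (fv M) → Disjoint (fv N₂) (fv N₁) →
             SubstFv M N₁ x₁ Q → SubstFv Q N₂ x₂ P →
             HasFv P (fv N₁ ++ fv N₂ ++ remove₂ x₁ x₂ (fv M))
subst-both {x₁} {x₂} {M} {N₁} {N₂} {Q} {P} wM wN₁ wN₂ x₁∈M x₂∈M x₁≢x₂ N₁#M N₂#M N₂#N₁ ih₁ ih₂ =
  hasFv wP eq
  where
  R : List ℕ
  R = remove₂ x₁ x₂ (fv M)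
  open HasFv (ih₁ wM wN₁ x₁∈M (λ m n → N₁#M n (remove-sub m))) renaming (wf to wQ; fv-eq to eQ)
  d₂ : Disjoint (remove x₂ (fv Q)) (fv N₂)
  d₂ m n with ∈-split (remove x₁ (fv M)) eQ (remove-sub m)
  ... | inj₁ q = N₂#M n (remove-sub q)
  ... | inj₂ q = N₂#N₁ n q
  open HasFv (ih₂ wQ wN₂ (∈-inl eQ (∈-remove⁺ x₂∈M (x₁≢x₂ ∘ sym))) d₂)
    renaming (wf to wP; fv-eq to eP)
  eq : fv P ≈ fv N₁ ++ fv N₂ ++ R
  eq = begin
    fv P                                              ≈⟨ eP ⟩
    remove x₂ (fv Q) ++ fv N₂                         ≈⟨ ++-cong (remove-cong eQ) ≈-refl ⟩
    remove x₂ (remove x₁ (fv M) ++ fv N₁) ++ fv N₂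
      ≡⟨ cong (_++ fv N₂) (remove-++ x₂ (remove x₁ (fv M)) (fv N₁)) ⟩
    (R ++ remove x₂ (fv N₁)) ++ fv N₂
      ≡⟨ cong (λ l → (R ++ l) ++ fv N₂) (remove-∉ (flip N₁#M x₂∈M)) ⟩
    (R ++ fv N₁) ++ fv N₂                             ≡⟨ ++-assoc R (fv N₁) (fv N₂) ⟩
    R ++ fv N₁ ++ fv N₂                               ≈⟨ ↭⇒≈ (++-comm R (fv N₁ ++ fv N₂)) ⟩
    (fv N₁ ++ fv N₂) ++ R                             ≡⟨ ++-assoc (fv N₁) (fv N₂) R ⟩
    fv N₁ ++ fv N₂ ++ R                               ∎
    where open ≈-Reasoning

subst-dupX : ∀ {x x₁ x₂ M N ys zs Q P} →
             Fresh (vars (dup x x₁ x₂ M) ++ vars N) N ys →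
             Fresh (vars (dup x x₁ x₂ M) ++ vars N ++ ys) N zs →
             SubstFv M (renameList (fv N) ys N) x₁ Q → SubstFv Q (renameList (fv N) zs N) x₂ P →
             SubstFv (dup x x₁ x₂ M) N x (dups (fv N) ys zs P)
subst-dupX {x} {x₁} {x₂} {M} {N} {ys} {zs} {Q} {P}
           (uys , |ys| , ys-fresh) (uzs , |zs| , zs-fresh) ih₁ ih₂
           (wf-dup wM x₁∈M x₂∈M x₁≢x₂ x∉R) wN _ d = hasFv wD eq
  where
  R : List ℕ
  R = remove₂ x₁ x₂ (fv M)
  ys#M : Disjoint ys (fv M)
  ys#M y m = lookup ys-fresh y (there (there (there (∈-++⁺ˡ (fv⊆vars M m)))))
  ys#N : Disjoint ys (fv N)
  ys#N y n = lookup ys-fresh y (there (there (there (∈-++⁺ʳ (vars M) (fv⊆vars N n)))))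
  zs#M : Disjoint zs (fv M)
  zs#M z m = lookup zs-fresh z (there (there (there (∈-++⁺ˡ (fv⊆vars M m)))))
  zs#N : Disjoint zs (fv N)
  zs#N z n = lookup zs-fresh z (there (there (there (∈-++⁺ʳ (vars M) (∈-++⁺ˡ (fv⊆vars N n))))))
  zs#ys : Disjoint zs ys
  zs#ys z y = lookup zs-fresh z (there (there (there (∈-++⁺ʳ (vars M) (∈-++⁺ʳ (vars N) y)))))
  N#R : Disjoint (fv N) R
  N#R n r = d (∈-remove⁺ {l = x ∷ R} (there r) (λ { refl → x∉R r })) n
  fv-N₁ : fv (renameList (fv N) ys N) ≡ ys
  fv-N₁ = fv-rename-fresh wN uys |ys| (flip ys#N)
  fv-N₂ : fv (renameList (fv N) zs N) ≡ zs
  fv-N₂ = fv-rename-fresh wN uzs |zs| (flip zs#N)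
  open HasFv (subst-both wM (wf-rename (fv N) ys wN) (wf-rename (fv N) zs wN) x₁∈M x₂∈M x₁≢x₂
                    (subst (λ l → Disjoint l (fv M)) (sym fv-N₁) ys#M)
                    (subst (λ l → Disjoint l (fv M)) (sym fv-N₂) zs#M)
                    (subst₂ Disjoint (sym fv-N₂) (sym fv-N₁) zs#ys) ih₁ ih₂)
    renaming (wf to wP; fv-eq to eP)
  eP′ : fv P ≈ ys ++ zs ++ R
  eP′ = ≈-trans eP (≈-reflexive (cong₂ (λ l l′ → l ++ l′ ++ R) fv-N₁ fv-N₂))
  all-distinct : Unique (fv N ++ ys ++ zs ++ R)
  all-distinct =
    unique-++ (unique-fv wN)
      (unique-++ uys (unique-++ uzs (unique-remove (unique-remove (unique-fv wM)))
                                    (λ z r → zs#M z (remove₂-sub r)))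
                     (disjoint-++ʳ (flip zs#ys) (λ y r → ys#M y (remove₂-sub r))))
      (disjoint-++ʳ (flip ys#N) (disjoint-++ʳ (flip zs#N) N#R))
  open HasFv (dups-fv (fv N) ys zs (sym |ys|) (sym |zs|) all-distinct (hasFv wP eP′))
    renaming (wf to wD; fv-eq to eD)
  eq : fv (dups (fv N) ys zs P) ≈ remove x (x ∷ R) ++ fv N
  eq = begin
    fv (dups (fv N) ys zs P)   ≈⟨ eD ⟩
    fv N ++ R                  ≈⟨ ↭⇒≈ (++-comm (fv N) R) ⟩
    R ++ fv N                  ≡⟨ cong (_++ fv N) (trans (remove-head x R) (remove-∉ x∉R)) ⟨
    remove x (x ∷ R) ++ fv N   ∎
    where open ≈-Reasoning

es-fv : ∀ {M N x P} → ES M N x P → SubstFv M N x P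
es-fv es-var                            = subst-var
es-fv (es-lam y≢x y∉N es)               = subst-lam y≢x y∉N (es-fv es)
es-fv (es-appL x∈M es)                  = subst-appL x∈M (es-fv es)
es-fv (es-appR x∈Q es)                  = subst-appR x∈Q (es-fv es)
es-fv (es-era y≢x es)                   = subst-era y≢x (es-fv es)
es-fv es-eraX                           = subst-eraX
es-fv (es-dup y≢x a b c d es)           = subst-dup y≢x a b c d (es-fv es)
es-fv (es-dupX fresh₁ fresh₂ es₁ es₂)   = subst-dupX fresh₁ fresh₂ (es-fv es₁) (es-fv es₂)

subst-fv : ∀ {M N x P} → WF M → WF N → Subst M N x P → fv P ≈ remove x (fv M) ++ fv N
subst-fv wM wN (x∈M , d , es) = HasFv.fv-eq (es-fv es wM wN x∈M d)

-- Structural equivalence preserves free variables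

remove-rename : ∀ x y l → y ∉ remove x l → remove y (map (swapV x y) l) ≡ remove x l
remove-rename x y []      _   = refl
remove-rename x y (z ∷ l) y∉ with z ≟ x
... | yes refl = begin
  remove y (swapV z y z ∷ map (swapV z y) l)
    ≡⟨ cong (λ v → remove y (v ∷ map (swapV z y) l)) (swapV-left z y) ⟩
  remove y (y ∷ map (swapV z y) l)            ≡⟨ remove-head y (map (swapV z y) l) ⟩
  remove y (map (swapV z y) l)                ≡⟨ remove-rename z y l (y∉ ∘ remove-⊆ {z} {l} there) ⟩
  remove z l                                  ≡⟨ remove-head z l ⟨
  remove z (z ∷ l)                            ∎
  where open ≡-Reasoning
... | no z≢x = begin
  remove y (swapV x y z ∷ map (swapV x y) l)
    ≡⟨ cong (λ v → remove y (v ∷ map (swapV x y) l)) (swapV-other z≢x z≢y) ⟩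
  remove y (z ∷ map (swapV x y) l)            ≡⟨ remove-skip (map (swapV x y) l) (z≢y ∘ sym) ⟩
  z ∷ remove y (map (swapV x y) l)
    ≡⟨ cong (z ∷_) (remove-rename x y l (y∉ ∘ remove-⊆ {x} {l} there)) ⟩
  z ∷ remove x l                              ≡⟨ remove-skip l (z≢x ∘ sym) ⟨
  remove x (z ∷ l)                            ∎
  where
  open ≡-Reasoning
  z≢y : z ≢ y
  z≢y refl = y∉ (∈-remove⁺ {l = z ∷ l} (here refl) z≢x)

strAx-fv : ∀ {M N} → StrAx M N → fv M ≈ fv N
strAx-fv (α-lam {x} {y} {M} y∉) = ≈-reflexive (sym (begin
  remove y (fv (swap x y M))           ≡⟨ cong (remove y) (fv-swap x y M) ⟩
  remove y (map (swapV x y) (fv M))    ≡⟨ remove-rename x y (fv M) y∉ ⟩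
  remove x (fv M)                      ∎))
  where open ≡-Reasoning
strAx-fv (α-dup {x} {x₁} {x₂} {y} {M} y∉) = ≈-reflexive (sym (cong (λ l → x ∷ remove x₂ l) (begin
  remove y (fv (swap x₁ y M))          ≡⟨ cong (remove y) (fv-swap x₁ y M) ⟩
  remove y (map (swapV x₁ y) (fv M))   ≡⟨ remove-rename x₁ y (fv M) y∉ ⟩
  remove x₁ (fv M)                     ∎)))
  where open ≡-Reasoning
strAx-fv (era-comm {x} {y}) = ↭⇒≈ (↭-swap x y ↭-refl)
strAx-fv (dup-sym {x} {x₁} {x₂} {M}) = ≈-reflexive (cong (x ∷_) (remove-comm x₂ x₁ (fv M)))
strAx-fv (dup-asc {x} {y} {z} {u} {v} {M}) = ≈-reflexive (cong (x ∷_) (begin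
  remove z (remove y (y ∷ remove₂ u v (fv M)))
    ≡⟨ cong (remove z) (remove-head y (remove₂ u v (fv M))) ⟩
  remove z (remove₂ v y (remove u (fv M)))      ≡⟨ cong (remove z) (remove-under₂ u v y (fv M)) ⟨
  remove z (remove u (remove₂ v y (fv M)))      ≡⟨ remove-comm z u (remove₂ v y (fv M)) ⟩
  remove u (remove z (remove₂ v y (fv M)))      ≡⟨ cong (remove u) (remove-under₂ z v y (fv M)) ⟩
  remove u (remove₂ v y (remove z (fv M)))
    ≡⟨ cong (remove u) (remove-head y (remove₂ z v (fv M))) ⟨
  remove u (remove y (y ∷ remove₂ z v (fv M)))  ∎))
  where open ≡-Reasoning
strAx-fv (dup-comm {x} {x₁} {x₂} {y} {y₁} {y₂} {M} x≢y₁ x≢y₂ y≢x₁ y≢x₂) = begin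
  x ∷ remove₂ x₁ x₂ (y ∷ remove₂ y₁ y₂ (fv M))
    ≡⟨ cong (x ∷_) (remove₂-skip (remove₂ y₁ y₂ (fv M)) (y≢x₁ ∘ sym) (y≢x₂ ∘ sym)) ⟩
  x ∷ y ∷ remove₂ x₁ x₂ (remove₂ y₁ y₂ (fv M))   ≈⟨ ↭⇒≈ (↭-swap x y ↭-refl) ⟩
  y ∷ x ∷ remove₂ x₁ x₂ (remove₂ y₁ y₂ (fv M))
    ≡⟨ cong (λ l → y ∷ x ∷ l) (remove₂-comm x₁ x₂ y₁ y₂ (fv M)) ⟩
  y ∷ x ∷ remove₂ y₁ y₂ (remove₂ x₁ x₂ (fv M))
    ≡⟨ cong (y ∷_) (remove₂-skip (remove₂ x₁ x₂ (fv M)) (x≢y₁ ∘ sym) (x≢y₂ ∘ sym)) ⟨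
  y ∷ remove₂ y₁ y₂ (x ∷ remove₂ x₁ x₂ (fv M))   ∎
  where open ≈-Reasoning

-- Reduction rules preserve free variables

↦-fv : ∀ {M N} → WF M → M ↦ N → fv M ≈ fv N
↦-fv (wf-app (wf-lam wM _) wN _) (β s) = ≈-sym (subst-fv wM wN s)
↦-fv _ (γ-lam {x} {x₁} {x₂} {y} {M} y≢x) = ≈-reflexive (sym (begin
  remove y (x ∷ remove₂ x₁ x₂ (fv M))   ≡⟨ remove-skip (remove₂ x₁ x₂ (fv M)) y≢x ⟩
  x ∷ remove y (remove₂ x₁ x₂ (fv M))   ≡⟨ cong (x ∷_) (remove-under₂ y x₁ x₂ (fv M)) ⟩
  x ∷ remove₂ x₁ x₂ (remove y (fv M))   ∎))
  where open ≡-Reasoning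
↦-fv _ (γ-appL {x} {x₁} {x₂} {M} {N} x₁∉N x₂∉N) = ≈-reflexive (cong (x ∷_)
  (trans (remove₂-++ x₁ x₂ (fv M) (fv N)) (cong (remove₂ x₁ x₂ (fv M) ++_) (remove₂-∉ x₁∉N x₂∉N))))
↦-fv _ (γ-appR {x} {x₁} {x₂} {M} {N} x₁∉M x₂∉M) = begin
  x ∷ remove₂ x₁ x₂ (fv M ++ fv N)   ≡⟨ cong (x ∷_) (remove₂-++ x₁ x₂ (fv M) (fv N)) ⟩
  x ∷ remove₂ x₁ x₂ (fv M) ++ remove₂ x₁ x₂ (fv N)
    ≡⟨ cong (λ l → x ∷ l ++ remove₂ x₁ x₂ (fv N)) (remove₂-∉ x₁∉M x₂∉M) ⟩
  x ∷ fv M ++ remove₂ x₁ x₂ (fv N)   ≈⟨ ↭⇒≈ (↭-sym (shift x (fv M) (remove₂ x₁ x₂ (fv N)))) ⟩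
  fv M ++ x ∷ remove₂ x₁ x₂ (fv N)   ∎
  where open ≈-Reasoning
↦-fv _ (ω-lam {x} {y} {M} x≢y) = ≈-reflexive (remove-skip (fv M) x≢y)
↦-fv _ ω-appL = ≈-refl
↦-fv _ (ω-appR {x} {M} {N}) = ↭⇒≈ (shift x (fv M) (fv N))
↦-fv _ (γω {x} {x₁} {x₂} {y} {M} y≢x₁ y≢x₂) = begin
  x ∷ remove₂ x₁ x₂ (y ∷ fv M)   ≡⟨ cong (x ∷_) (remove₂-skip (fv M) (y≢x₁ ∘ sym) (y≢x₂ ∘ sym)) ⟩
  x ∷ y ∷ remove₂ x₁ x₂ (fv M)   ≈⟨ ↭⇒≈ (↭-swap x y ↭-refl) ⟩
  y ∷ x ∷ remove₂ x₁ x₂ (fv M)   ∎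
  where open ≈-Reasoning
↦-fv (wf-dup (wf-era wM x₁∉M) _ _ _ _) (γω-X {x} {x₁} {x₂} {M} {P} s) = begin
  x ∷ remove₂ x₁ x₂ (x₁ ∷ fv M)   ≡⟨ cong (λ l → x ∷ remove x₂ l)
                                         (trans (remove-head x₁ (fv M)) (remove-∉ x₁∉M)) ⟩
  x ∷ remove x₂ (fv M)            ≈⟨ ↭⇒≈ (++-comm (x ∷ []) (remove x₂ (fv M))) ⟩
  remove x₂ (fv M) ++ x ∷ []      ≈⟨ subst-fv wM wf-var s ⟨
  fv P                            ∎
  where open ≈-Reasoning

ctx-fv : ∀ {R : Term → Term → Set} → (∀ {M N} → WF M → R M N → fv M ≈ fv N) →
         ∀ {M N} → WF M → Ctx R M N → fv M ≈ fv N
ctx-fv R-fv w                   (here r)   = R-fv w r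
ctx-fv R-fv (wf-lam w _)        (c-lam c)  = remove-cong (ctx-fv R-fv w c)
ctx-fv R-fv (wf-app w _ _)      (c-appL c) = ++-cong (ctx-fv R-fv w c) ≈-refl
ctx-fv R-fv (wf-app {M = P} _ w _) (c-appR c) = ++-cong (≈-refl {fv P}) (ctx-fv R-fv w c)
ctx-fv R-fv (wf-era w _)        (c-era c)  = ∷-cong refl (ctx-fv R-fv w c)
ctx-fv R-fv (wf-dup w _ _ _ _)  (c-dup c)  = ∷-cong refl (remove₂-cong (ctx-fv R-fv w c))

symAx-fv : ∀ {M N} → SymAx M N → fv M ≈ fv N
symAx-fv (fwd a) = strAx-fv a
symAx-fv (bwd a) = ≈-sym (strAx-fv a)

star-fv : ∀ {R : Term → Term → Set} → (∀ {M N} → R M N → fv M ≈ fv N) →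
          ∀ {M N} → Star R M N → fv M ≈ fv N
star-fv R-fv = fold (λ M N → fv M ≈ fv N) (λ r e → ≈-trans (R-fv r) e) ≈-refl

≡ₛ-fv : ∀ {M N} → M ≡ₛ N → fv M ≈ fv N
≡ₛ-fv = star-fv (λ (wM , _ , c) → ctx-fv (λ _ → symAx-fv) wM c)

⟶-fv : ∀ {M N} → M ⟶ N → fv M ≈ fv N
⟶-fv (step M≡M′ wM′ M′↦N′ _ N′≡N) =
  ≈-trans (≡ₛ-fv M≡M′) (≈-trans (ctx-fv ↦-fv wM′ M′↦N′) (≡ₛ-fv N′≡N))

-- Theorem: if M ↠ N then Fv(M) = Fv(N).  Every step of ⟶ carries the
-- well-formedness it needs.
mainTheorem10 : ∀ {M N} → WF M → M ↠ N → fv M ∼[ set ] fv N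
mainTheorem10 _ = star-fv ⟶-fv
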